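{- Let $a,b,c$ be non-zero integers with $a,b$ not both positive, and let $\mathbf{X}^*_{a,b,c}\subseteq\mathbb{A}^3_{\mathbb{Z}}$ be defined by $ax^2+by^2+c^2z^2=1$. Let $p$ be an odd prime. Then $\mathbf{X}^*_{a,b,c}(\mathbb{Z}_p)\neq\emptyset$ if and only if $p\nmid\gcd(a,b,c)$ and both of the following hold: (i) if $p\mid\gcd(a,c)$ then $b$ is a quadratic residue modulo $p$; (ii) if $p\mid\gcd(b,c)$ then $a$ is a quadratic residue modulo $p$. -}

module Defs where

open import Data.Nat using (ℕ; suc)
open import Data.Integer using (ℤ; +_; _+_; _-_; _*_; _^_; 1ℤ)
open import Data.Integer.Divisibility using (_∣_)
open import Data.Product using (Σ; ∃; _×_)

_≡_[mod_] : ℤ → ℤ → ℕ → Set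
x ≡ y [mod m ] = (+ m) ∣ (x - y)

-- The p-adic integers ℤ_p = lim_k ℤ/p^k ℤ, represented as coherent
-- sequences: x k is a representative of the class of x modulo p^k,
-- and x (k+1) ≡ x k (mod p^k).
record ℤ[_] (p : ℕ) : Set where
  constructor padic
  field
    digits   : ℕ → ℤ
    coherent : ∀ k → digits (suc k) ≡ digits k [mod (p Data.Nat.^ k) ]
open ℤ[_] public

-- A ℤ_p-point of X*_{a,b,c} : a x^2 + b y^2 + c^2 z^2 = 1.
-- An equation holds in ℤ_p = lim ℤ/p^k iff it holds in every ℤ/p^k.
IsPoint : (p : ℕ) (a b c : ℤ) → ℤ[ p ] → ℤ[ p ] → ℤ[ p ] → Set
IsPoint p a b c x y z =
  ∀ k → (a * (digits x k ^ 2) + b * (digits y k ^ 2) + (c ^ 2) * (digits z k ^ 2))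
          ≡ 1ℤ [mod (p Data.Nat.^ k) ]

HasZpPoint : (p : ℕ) (a b c : ℤ) → Set
HasZpPoint p a b c = Σ ℤ[ p ] λ x → Σ ℤ[ p ] λ y → Σ ℤ[ p ] λ z → IsPoint p a b c x y z

QuadRes : ℤ → ℕ → Set
QuadRes b p = ∃ λ (t : ℤ) → (t * t) ≡ b [mod p ]

{-# OPTIONS --safe #-}
module Submission where

-- Reducing a ℤ_p-point modulo p: if p divides a, b and c the equation reads 0 ≡ 1,
-- and if p divides a and c it reads b y² ≡ 1, so that b ≡ (b y)².  Conversely, for
-- odd p a solution modulo p in which one variable has a unit coefficient and a unit
-- value lifts to ℤ_p by Newton's iteration y ↦ y − (A y² − B) h, h ≡ (2 A y₀)⁻¹.
-- Such a solution exists: z = c⁻¹ when p ∤ c; y = t / b when p ∣ c and b ≡ t² is a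
-- unit; and when a and b are units, the values of a x² and of 1 − b y² for
-- 0 ≤ x, y ≤ (p−1)/2 are p + 1 residues, distinct within each family, so that
-- a x² ≡ 1 − b y² for some x, y.

open import Data.Empty using (⊥-elim)
open import Data.Fin as Fin using (Fin; toℕ; fromℕ<; splitAt; join)
import Data.Fin.Properties as Finₚ
open import Data.Integer using (ℤ; +_; -[1+_]; 0ℤ; 1ℤ; _+_; _-_; _*_; -_; _^_; ∣_∣; _<_)
import Data.Integer.DivMod as ℤ
open import Data.Integer.Divisibility using (_∣_)
open import Data.Integer.Divisibility.Signed as Signed
  using (divides; ∣ᵤ⇒∣; ∣⇒∣ᵤ; _∣?_) renaming (_∣_ to _∣ₛ_)
open import Data.Integer.GCD using (gcd; gcd[i,j]∣i; gcd[i,j]∣j; gcd-greatest)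
import Data.Integer.Properties as ℤₚ
open import Data.Integer.Tactic.RingSolver using (solve-∀)
open import Data.Nat as ℕ using (ℕ; zero; suc)
open import Data.Nat.Coprimality using (Coprime; coprime-Bézout)
import Data.Nat.Divisibility as ℕᵈ
open import Data.Nat.GCD using (module Bézout)
open import Data.Nat.Primality
  using (Prime; prime⇒nonZero; prime⇒irreducible; euclidsLemma; ¬prime[1]; irreducible[2])
import Data.Nat.Properties as ℕₚ
open import Data.Product using (_×_; _,_; proj₁; proj₂; ∃; ∃₂)
open import Data.Sum using (_⊎_; inj₁; inj₂)
open import Function using (_∘_; _$_)
open import Function.Bundles using (_⇔_; mk⇔)
open import Relation.Binary.PropositionalEquality
  using (_≡_; _≢_; refl; sym; trans; cong; cong₂; subst; subst₂; module ≡-Reasoning)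
open import Relation.Nullary using (¬_; yes; no; contradiction)

open import Defs

*-pres-∣ₛ : ∀ {k l m n} → k ∣ₛ m → l ∣ₛ n → k * l ∣ₛ m * n
*-pres-∣ₛ {k} {n = n} k∣m l∣n = Signed.∣-trans (Signed.*-monoʳ-∣ k l∣n) (Signed.*-monoˡ-∣ n k∣m)

∣-small⇒≡0 : ∀ {m i} → + m ∣ₛ i → ∣ i ∣ ℕ.< m → i ≡ 0ℤ
∣-small⇒≡0 {i = i} m∣i |i|<m with ∣ i ∣ ℕ.≟ 0
... | yes |i|≡0 = ℤₚ.∣i∣≡0⇒i≡0 |i|≡0
... | no  |i|≢0 = contradiction (∣⇒∣ᵤ m∣i) (ℕᵈ.>⇒∤ {{ℕ.≢-nonZero |i|≢0}} |i|<m)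

∣gcd⇒∣ˡ : ∀ {m} i j → + m ∣ gcd i j → + m ∣ i
∣gcd⇒∣ˡ i j k∣g = ℕᵈ.∣-trans k∣g (gcd[i,j]∣i i j)

∣gcd⇒∣ʳ : ∀ {m} i j → + m ∣ gcd i j → + m ∣ j
∣gcd⇒∣ʳ i j k∣g = ℕᵈ.∣-trans k∣g (gcd[i,j]∣j i j)

∣ₛ⇒∣gcd : ∀ {m i j} → + m ∣ₛ i → + m ∣ₛ j → + m ∣ gcd i j
∣ₛ⇒∣gcd {m} {i} {j} m∣i m∣j = gcd-greatest {i} {j} {+ m} (∣⇒∣ᵤ m∣i) (∣⇒∣ᵤ m∣j)

pos-^ : ∀ m k → + (m ℕ.^ k) ≡ (+ m) ^ k
pos-^ m zero    = refl
pos-^ m (suc k) = trans (ℤₚ.pos-* m (m ℕ.^ k)) (cong (λ t → + m * t) (pos-^ m k))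

p∣p^suc : ∀ p k → + p ∣ₛ (+ p) ^ suc k
p∣p^suc p k = Signed.∣m⇒∣m*n ((+ p) ^ k) Signed.∣-refl

p^k∣p^suc : ∀ p k → (+ p) ^ k ∣ₛ (+ p) ^ suc k
p^k∣p^suc p k = Signed.∣n⇒∣m*n (+ p) Signed.∣-refl

even⊎odd : ∀ n → ∃ (λ m → n ≡ m ℕ.+ m) ⊎ ∃ (λ m → n ≡ suc (m ℕ.+ m))
even⊎odd zero    = inj₁ (0 , refl)
even⊎odd (suc n) with even⊎odd n
... | inj₁ (m , refl) = inj₂ (m , refl)
... | inj₂ (m , refl) = inj₁ (suc m , cong suc (sym (ℕₚ.+-suc m m)))

n+n≡n*2 : ∀ n → n ℕ.+ n ≡ n ℕ.* 2
n+n≡n*2 n = trans (cong (n ℕ.+_) (sym (ℕₚ.+-identityʳ n))) (ℕₚ.*-comm 2 n)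

splitAt-injective : ∀ m {n} {i j : Fin (m ℕ.+ n)} → splitAt m i ≡ splitAt m j → i ≡ j
splitAt-injective m {n} {i} {j} eq =
  trans (sym (Finₚ.join-splitAt m n i)) (trans (cong (join m n) eq) (Finₚ.join-splitAt m n j))

quadric : ℤ → ℤ → ℤ → ℤ → ℤ → ℤ → ℤ
quadric a b c x y z = a * x * x + b * y * y + c * c * z * z

quadric-^2 : ∀ a b c x y z → a * x ^ 2 + b * y ^ 2 + c ^ 2 * z ^ 2 ≡ quadric a b c x y z
quadric-^2 = expanded
  where
  -- solve-∀ does not recognise ℤ's _^_, so the powers are written out as they unfold.
  expanded : ∀ a b c x y z →
    a * (x * (x * 1ℤ)) + b * (y * (y * 1ℤ)) + c * (c * 1ℤ) * (z * (z * 1ℤ))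
      ≡ a * x * x + b * y * y + c * c * z * z
  expanded = solve-∀

-- Records rather than Σ-types, so that their indices can be inferred by unification.
record PointMod (p : ℕ) (a b c : ℤ) : Set where
  constructor pointMod
  field
    x y z    : ℤ
    equation : + p ∣ₛ quadric a b c x y z - 1ℤ

record ZpRoot (p : ℕ) (A B : ℤ) : Set where
  constructor zpRoot
  field
    root   : ℤ[ p ]
    solves : ∀ k → (+ p) ^ k ∣ₛ A * digits root k * digits root k - B

module _ {p : ℕ} where

  padicOf : (s : ℕ → ℤ) → (∀ k → (+ p) ^ k ∣ₛ s (suc k) - s k) → ℤ[ p ]
  padicOf s coherent = padic s (λ k → ∣⇒∣ᵤ (subst (_∣ₛ _) (sym (pos-^ p k)) (coherent k)))

  constant : ℤ → ℤ[ p ]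
  constant c = padicOf (λ _ → c) (λ _ → divides 0ℤ (ℤₚ.+-inverseʳ c))

  pointOf : ∀ a b c (x y z : ℤ[ p ]) →
            (∀ k → (+ p) ^ k ∣ₛ quadric a b c (digits x k) (digits y k) (digits z k) - 1ℤ) →
            HasZpPoint p a b c
  pointOf a b c x y z solves = x , y , z , λ k →
    ∣⇒∣ᵤ (subst₂ _∣ₛ_ (sym (pos-^ p k))
                     (cong (_- 1ℤ) (sym (quadric-^2 a b c (digits x k) (digits y k) (digits z k))))
                     (solves k))

  HasZpPoint-swap : ∀ a b c → HasZpPoint p a b c → HasZpPoint p b a c
  HasZpPoint-swap a b c (x , y , z , point) = y , x , z , λ k →
    subst (λ t → + (p ℕ.^ k) ∣ t + c ^ 2 * digits z k ^ 2 - 1ℤ)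
          (ℤₚ.+-comm (a * digits x k ^ 2) (b * digits y k ^ 2)) (point k)

  reduce-mod-p : ∀ a b c → HasZpPoint p a b c → PointMod p a b c
  reduce-mod-p a b c (x , y , z , point) = pointMod X Y Z $
    subst₂ _∣ₛ_ (cong +_ (ℕₚ.^-identityʳ p)) (cong (_- 1ℤ) (quadric-^2 a b c X Y Z))
           (∣ᵤ⇒∣ (point 1))
    where
    X = digits x 1
    Y = digits y 1
    Z = digits z 1

  PointMod⇒QuadRes : ∀ {a b c} → PointMod p a b c → + p ∣ gcd a c → QuadRes b p
  PointMod⇒QuadRes {a} {b} {c} (pointMod x y z p∣q-1) p∣gcd =
    b * y , ∣⇒∣ᵤ (subst (_ ∣ₛ_) (scale b y) (Signed.∣n⇒∣m*n b p∣byy-1))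
    where
    p∣a : + p ∣ₛ a
    p∣a = ∣ᵤ⇒∣ (∣gcd⇒∣ˡ a c p∣gcd)
    p∣c : + p ∣ₛ c
    p∣c = ∣ᵤ⇒∣ (∣gcd⇒∣ʳ a c p∣gcd)
    isolate : ∀ a b c x y z →
      a * x * x + b * y * y + c * c * z * z - 1ℤ - a * x * x - c * c * z * z ≡ b * y * y - 1ℤ
    isolate = solve-∀
    scale : ∀ b y → b * (b * y * y - 1ℤ) ≡ b * y * (b * y) - b
    scale = solve-∀
    p∣byy-1 : + p ∣ₛ b * y * y - 1ℤ
    p∣byy-1 = subst (_ ∣ₛ_) (isolate a b c x y z)
      (Signed.∣m∣n⇒∣m-n (Signed.∣m∣n⇒∣m-n p∣q-1 (Signed.∣m⇒∣m*n x (Signed.∣m⇒∣m*n x p∣a)))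
                        (Signed.∣m⇒∣m*n z (Signed.∣m⇒∣m*n z (Signed.∣m⇒∣m*n c p∣c))))

-- With e = A y² − B, the Newton step y − e h has error (1 − 2 A y h) e + A h² e²,
-- which is quadratic in e as soon as 2 A y h ≡ 1.
newton-error : ∀ A B h y →
  A * (y - (A * y * y - B) * h) * (y - (A * y * y - B) * h) - B
    ≡ (1ℤ - + 2 * A * y * h) * (A * y * y - B) + A * h * h * ((A * y * y - B) * (A * y * y - B))
newton-error = solve-∀

newton-lift : ∀ {p k} A B h y → (+ p) ^ suc k ∣ₛ A * y * y - B → + p ∣ₛ 1ℤ - + 2 * A * y * h →
  (+ p) ^ suc (suc k) ∣ₛ A * (y - (A * y * y - B) * h) * (y - (A * y * y - B) * h) - B
newton-lift {p} {k} A B h y p^k+1∣e p∣slope =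
  subst (_ ∣ₛ_) (sym (newton-error A B h y))
    (Signed.∣m∣n⇒∣m+n (*-pres-∣ₛ p∣slope p^k+1∣e)
                      (Signed.∣n⇒∣m*n (A * h * h)
                        (Signed.∣-trans (Signed.*-monoˡ-∣ ((+ p) ^ suc k) (p∣p^suc p k))
                                        (*-pres-∣ₛ p^k+1∣e p^k+1∣e))))

module _ {p : ℕ} (p-prime : Prime p) where

  prime∤1 : ¬ + p ∣ₛ 1ℤ
  prime∤1 p∣1 = ¬prime[1] (subst Prime (ℕᵈ.∣1⇒≡1 (∣⇒∣ᵤ p∣1)) p-prime)

  euclidsLemmaℤ : ∀ i j → + p ∣ₛ i * j → + p ∣ₛ i ⊎ + p ∣ₛ j
  euclidsLemmaℤ i j p∣ij
    with euclidsLemma ∣ i ∣ ∣ j ∣ p-prime (subst (p ℕᵈ.∣_) (ℤₚ.abs-* i j) (∣⇒∣ᵤ p∣ij))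
  ... | inj₁ p∣i = inj₁ (∣ᵤ⇒∣ p∣i)
  ... | inj₂ p∣j = inj₂ (∣ᵤ⇒∣ p∣j)

  prime∤* : ∀ {i j} → ¬ + p ∣ₛ i → ¬ + p ∣ₛ j → ¬ + p ∣ₛ i * j
  prime∤* {i} {j} p∤i p∤j p∣ij with euclidsLemmaℤ i j p∣ij
  ... | inj₁ p∣i = p∤i p∣i
  ... | inj₂ p∣j = p∤j p∣j

  ∣m⇒∤m-1 : ∀ {m} → + p ∣ₛ m → ¬ + p ∣ₛ m - 1ℤ
  ∣m⇒∤m-1 {m} p∣m p∣m-1 =
    prime∤1 (subst (_ ∣ₛ_) (cancel m) (Signed.∣m∣n⇒∣m-n p∣m p∣m-1))
    where
    cancel : ∀ m → m - (m - 1ℤ) ≡ 1ℤ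
    cancel = solve-∀

  inverse∤ : ∀ u h → + p ∣ₛ u * h - 1ℤ → ¬ + p ∣ₛ h
  inverse∤ u h p∣uh-1 p∣h = ∣m⇒∤m-1 (Signed.∣n⇒∣m*n u p∣h) p∣uh-1

  prime∤⇒coprime : ∀ {m} → ¬ p ℕᵈ.∣ m → Coprime p m
  prime∤⇒coprime p∤m (d∣p , d∣m) with prime⇒irreducible p-prime d∣p
  ... | inj₁ d≡1  = d≡1
  ... | inj₂ refl = ⊥-elim (p∤m d∣m)

  inverse-mod-primeℕ : ∀ {m} → ¬ p ℕᵈ.∣ m → ∃ λ h → + p ∣ₛ + m * h - 1ℤ
  inverse-mod-primeℕ {m} p∤m with coprime-Bézout (prime∤⇒coprime p∤m)
  ... | Bézout.+- x y eq = - + y , divides (- + x) (begin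
      + m * - + y - 1ℤ       ≡⟨ negate (+ m) (+ y) ⟩
      - (1ℤ + + y * + m)     ≡⟨ cong -_ toℤ ⟩
      - (+ x * + p)          ≡⟨ ℤₚ.neg-distribˡ-* (+ x) (+ p) ⟩
      - + x * + p            ∎)
    where
    open ≡-Reasoning
    negate : ∀ m y → m * - y - 1ℤ ≡ - (1ℤ + y * m)
    negate = solve-∀
    toℤ : 1ℤ + + y * + m ≡ + x * + p
    toℤ = trans (cong (λ t → 1ℤ + t) (sym (ℤₚ.pos-* y m))) (trans (cong +_ eq) (ℤₚ.pos-* x p))
  ... | Bézout.-+ x y eq = + y , divides (+ x) (begin
      + m * + y - 1ℤ         ≡⟨ cong (_- 1ℤ) (ℤₚ.pos-* m y) ⟨
      + (m ℕ.* y) - 1ℤ       ≡⟨ cong (λ n → + n - 1ℤ) (trans (ℕₚ.*-comm m y) (sym eq)) ⟩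
      + (1 ℕ.+ x ℕ.* p) - 1ℤ ≡⟨ ℤₚ.pos-* x p ⟩
      + x * + p              ∎)
    where open ≡-Reasoning

  inverse-mod-prime : ∀ u → ¬ + p ∣ₛ u → ∃ λ h → + p ∣ₛ u * h - 1ℤ
  inverse-mod-prime (+ m)      p∤u = inverse-mod-primeℕ (p∤u ∘ ∣ᵤ⇒∣)
  inverse-mod-prime -[1+ m ]   p∤u with inverse-mod-primeℕ {suc m} (p∤u ∘ ∣ᵤ⇒∣)
  ... | h , p∣mh-1 = - h , subst (_ ∣ₛ_) (negate² (+ suc m) h) p∣mh-1
    where
    negate² : ∀ m h → m * h - 1ℤ ≡ - m * - h - 1ℤ
    negate² = solve-∀

  scaled-squares-injective : ∀ {u} i j → ¬ + p ∣ₛ u → i ℕ.+ j ℕ.< p →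
                             + p ∣ₛ u * + i * + i - u * + j * + j → i ≡ j
  scaled-squares-injective {u} i j p∤u i+j<p p∣diff
    with euclidsLemmaℤ u ((+ i - + j) * (+ i + + j)) (subst (_ ∣ₛ_) (factor u (+ i) (+ j)) p∣diff)
    where
    factor : ∀ u i j → u * i * i - u * j * j ≡ u * ((i - j) * (i + j))
    factor = solve-∀
  ... | inj₁ p∣u = contradiction p∣u p∤u
  ... | inj₂ p∣prod with euclidsLemmaℤ (+ i - + j) (+ i + + j) p∣prod
  ...   | inj₁ p∣i-j = ℤₚ.+-injective (ℤₚ.i-j≡0⇒i≡j (+ i) (+ j) (∣-small⇒≡0 p∣i-j |i-j|<p))
    where
    |i-j|<p : ∣ + i - + j ∣ ℕ.< p
    |i-j|<p = ℕₚ.≤-<-trans (ℕₚ.≤-trans (ℕₚ.≤-reflexive (cong ∣_∣ (ℤₚ.[+m]-[+n]≡m⊖n i j)))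
                                        (ℕₚ.≤-trans (ℤₚ.∣m⊝n∣≤m⊔n i j) (ℕₚ.m⊔n≤m+n i j)))
                           i+j<p
  ...   | inj₂ p∣i+j = trans (ℕₚ.m+n≡0⇒m≡0 i i+j≡0) (sym (ℕₚ.m+n≡0⇒n≡0 i i+j≡0))
    where
    i+j≡0 : i ℕ.+ j ≡ 0
    i+j≡0 = ℤₚ.+-injective (∣-small⇒≡0 p∣i+j i+j<p)

  PointMod⇒p∤gcd : ∀ {a b c} → PointMod p a b c → ¬ + p ∣ gcd (gcd a b) c
  PointMod⇒p∤gcd {a} {b} {c} (pointMod x y z p∣q-1) p∣gcd = ∣m⇒∤m-1 p∣q p∣q-1
    where
    p∣ab : + p ∣ gcd a b
    p∣ab = ∣gcd⇒∣ˡ (gcd a b) c p∣gcd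
    p∣a : + p ∣ₛ a
    p∣a = ∣ᵤ⇒∣ (∣gcd⇒∣ˡ a b p∣ab)
    p∣b : + p ∣ₛ b
    p∣b = ∣ᵤ⇒∣ (∣gcd⇒∣ʳ a b p∣ab)
    p∣c : + p ∣ₛ c
    p∣c = ∣ᵤ⇒∣ (∣gcd⇒∣ʳ (gcd a b) c p∣gcd)
    p∣q : + p ∣ₛ quadric a b c x y z
    p∣q = Signed.∣m∣n⇒∣m+n
            (Signed.∣m∣n⇒∣m+n (Signed.∣m⇒∣m*n x (Signed.∣m⇒∣m*n x p∣a))
                              (Signed.∣m⇒∣m*n y (Signed.∣m⇒∣m*n y p∣b)))
            (Signed.∣m⇒∣m*n z (Signed.∣m⇒∣m*n z (Signed.∣m⇒∣m*n c p∣c)))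

  necessary : ∀ a b c → HasZpPoint p a b c →
              ¬ + p ∣ gcd (gcd a b) c
              × (+ p ∣ gcd a c → QuadRes b p)
              × (+ p ∣ gcd b c → QuadRes a p)
  necessary a b c point =
    PointMod⇒p∤gcd modp , PointMod⇒QuadRes modp , PointMod⇒QuadRes modp′
    where
    modp  = reduce-mod-p a b c point
    modp′ = reduce-mod-p b a c (HasZpPoint-swap a b c point)

  module _ (p≢2 : p ≢ 2) where

    odd-prime∤2 : ¬ + p ∣ₛ + 2
    odd-prime∤2 p∣2 with irreducible[2] (∣⇒∣ᵤ p∣2)
    ... | inj₁ p≡1 = ¬prime[1] (subst Prime p≡1 p-prime)
    ... | inj₂ p≡2 = p≢2 p≡2

    hensel : ∀ {A} B {y₀} → ¬ + p ∣ₛ A → ¬ + p ∣ₛ y₀ → + p ∣ₛ A * y₀ * y₀ - B → ZpRoot p A B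
    hensel {A} B {y₀} p∤A p∤y₀ p∣e₀ = zpRoot (padicOf approx approx-coherent) p^k∣error
      where
      inverse : ∃ λ h → + p ∣ₛ + 2 * A * y₀ * h - 1ℤ
      inverse = inverse-mod-prime (+ 2 * A * y₀) (prime∤* (prime∤* odd-prime∤2 p∤A) p∤y₀)

      h : ℤ
      h = proj₁ inverse

      approx : ℕ → ℤ
      approx zero    = y₀
      approx (suc k) = approx k - (A * approx k * approx k - B) * h

      negate : ∀ q → - (q - 1ℤ) ≡ 1ℤ - q
      negate = solve-∀

      slope-step : ∀ A B h y →
        1ℤ - + 2 * A * y * h + + 2 * A * h * h * (A * y * y - B)
          ≡ 1ℤ - + 2 * A * (y - (A * y * y - B) * h) * h
      slope-step = solve-∀

      invariant : ∀ k → (+ p) ^ suc k ∣ₛ A * approx k * approx k - B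
                      × + p ∣ₛ 1ℤ - + 2 * A * approx k * h
      invariant zero = subst (_∣ₛ A * y₀ * y₀ - B) (sym (ℤₚ.*-identityʳ (+ p))) p∣e₀
                     , subst (_ ∣ₛ_) (negate (+ 2 * A * y₀ * h)) (Signed.∣m⇒∣-m (proj₂ inverse))
      invariant (suc k) = newton-lift {k = k} A B h (approx k) p^k+1∣e p∣slope
                        , subst (_ ∣ₛ_) (slope-step A B h (approx k))
                            (Signed.∣m∣n⇒∣m+n p∣slope (Signed.∣n⇒∣m*n (+ 2 * A * h * h) p∣e))
        where
        p^k+1∣e = proj₁ (invariant k)
        p∣slope = proj₂ (invariant k)
        p∣e     = Signed.∣-trans (p∣p^suc p k) p^k+1∣e

      p^k∣error : ∀ k → (+ p) ^ k ∣ₛ A * approx k * approx k - B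
      p^k∣error k = Signed.∣-trans (p^k∣p^suc p k) (proj₁ (invariant k))

      displacement : ∀ y e h → - h * e ≡ y - e * h - y
      displacement = solve-∀

      approx-coherent : ∀ k → (+ p) ^ k ∣ₛ approx (suc k) - approx k
      approx-coherent k = subst (_ ∣ₛ_) (displacement (approx k) (A * approx k * approx k - B) h)
                         (Signed.∣n⇒∣m*n (- h) (p^k∣error k))

    odd-prime≡1+n+n : ∃ λ n → p ≡ suc (n ℕ.+ n)
    odd-prime≡1+n+n with even⊎odd p
    ... | inj₂ odd = odd
    ... | inj₁ (n , p≡n+n) with prime⇒irreducible p-prime (ℕᵈ.divides n (trans p≡n+n (n+n≡n*2 n)))
    ...   | inj₁ ()
    ...   | inj₂ 2≡p = contradiction (sym 2≡p) p≢2

    private instance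
      p-nonZero : ℕ.NonZero p
      p-nonZero = prime⇒nonZero p-prime

    residue : ℤ → Fin p
    residue i = fromℕ< (ℤ.n%ℕd<d i p)

    ≡-residue⇒∣- : ∀ i j → residue i ≡ residue j → + p ∣ₛ i - j
    ≡-residue⇒∣- i j same = divides (qᵢ - qⱼ) (begin
      i - j
        ≡⟨ cong₂ _-_ (ℤ.a≡a%ℕn+[a/ℕn]*n i p) (ℤ.a≡a%ℕn+[a/ℕn]*n j p) ⟩
      (+ rᵢ + qᵢ * + p) - (+ rⱼ + qⱼ * + p)
        ≡⟨ cong (λ r → (+ rᵢ + qᵢ * + p) - (+ r + qⱼ * + p)) rᵢ≡rⱼ ⟨
      (+ rᵢ + qᵢ * + p) - (+ rᵢ + qⱼ * + p)
        ≡⟨ cancel (+ rᵢ) qᵢ qⱼ (+ p) ⟩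
      (qᵢ - qⱼ) * + p
        ∎)
      where
      open ≡-Reasoning
      qᵢ = i ℤ./ℕ p
      qⱼ = j ℤ./ℕ p
      rᵢ = i ℤ.%ℕ p
      rⱼ = j ℤ.%ℕ p
      rᵢ≡rⱼ : rᵢ ≡ rⱼ
      rᵢ≡rⱼ = trans (sym (Finₚ.toℕ-fromℕ< _)) (trans (cong toℕ same) (Finₚ.toℕ-fromℕ< _))
      cancel : ∀ r q q′ m → (r + q * m) - (r + q′ * m) ≡ (q - q′) * m
      cancel = solve-∀

    conic-mod-p : ∀ {a b} → ¬ + p ∣ₛ a → ¬ + p ∣ₛ b →
                  ∃₂ λ x y → + p ∣ₛ a * x * x + b * y * y - 1ℤ
    conic-mod-p {a} {b} p∤a p∤b = collision-of (Finₚ.pigeonhole p<2+n+n residues)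
      where
      Solution = ∃₂ λ x y → + p ∣ₛ a * x * x + b * y * y - 1ℤ

      n = proj₁ odd-prime≡1+n+n
      p≡1+n+n = proj₂ odd-prime≡1+n+n

      p<2+n+n : p ℕ.< suc n ℕ.+ suc n
      p<2+n+n = subst (ℕ._< suc n ℕ.+ suc n) (sym p≡1+n+n)
                      (ℕ.s≤s (ℕₚ.≤-reflexive (sym (ℕₚ.+-suc n n))))

      sum<p : ∀ (i j : Fin (suc n)) → toℕ i ℕ.+ toℕ j ℕ.< p
      sum<p i j = subst (toℕ i ℕ.+ toℕ j ℕ.<_) (sym p≡1+n+n)
                        (ℕ.s≤s (ℕₚ.+-mono-≤ (Finₚ.toℕ≤pred[n] i) (Finₚ.toℕ≤pred[n] j)))

      value : Fin (suc n) ⊎ Fin (suc n) → ℤ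
      value (inj₁ i) = a * + toℕ i * + toℕ i
      value (inj₂ j) = 1ℤ - b * + toℕ j * + toℕ j

      residues : Fin (suc n ℕ.+ suc n) → Fin p
      residues = residue ∘ value ∘ splitAt (suc n)

      p∤-b : ¬ + p ∣ₛ - b
      p∤-b p∣-b = p∤b (subst (_ ∣ₛ_) (ℤₚ.neg-involutive b) (Signed.∣m⇒∣-m p∣-b))

      rearrange : ∀ a b x y → a * x * x - (1ℤ - b * y * y) ≡ a * x * x + b * y * y - 1ℤ
      rearrange = solve-∀

      negate : ∀ b x y → (1ℤ - b * x * x) - (1ℤ - b * y * y) ≡ - b * x * x - - b * y * y
      negate = solve-∀

      mixed : ∀ i j → residue (value (inj₁ i)) ≡ residue (value (inj₂ j)) → Solution
      mixed i j same = + toℕ i , + toℕ j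
                     , subst (_ ∣ₛ_) (rearrange a b (+ toℕ i) (+ toℕ j))
                             (≡-residue⇒∣- (value (inj₁ i)) (value (inj₂ j)) same)

      collision : ∀ u v → u ≢ v → residue (value u) ≡ residue (value v) → Solution
      collision (inj₁ i) (inj₁ j) u≢v same = contradiction (cong inj₁ (Finₚ.toℕ-injective
        (scaled-squares-injective (toℕ i) (toℕ j) p∤a (sum<p i j)
          (≡-residue⇒∣- (value (inj₁ i)) (value (inj₁ j)) same)))) u≢v
      collision (inj₂ i) (inj₂ j) u≢v same = contradiction (cong inj₂ (Finₚ.toℕ-injective
        (scaled-squares-injective (toℕ i) (toℕ j) p∤-b (sum<p i j)
          (subst (_ ∣ₛ_) (negate b (+ toℕ i) (+ toℕ j))
                 (≡-residue⇒∣- (value (inj₂ i)) (value (inj₂ j)) same))))) u≢v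
      collision (inj₁ i) (inj₂ j) _ same = mixed i j same
      collision (inj₂ j) (inj₁ i) _ same = mixed i j (sym same)

      collision-of : (∃₂ λ i j → i Fin.< j × residues i ≡ residues j) → Solution
      collision-of (i , j , i<j , same) =
        collision (splitAt (suc n) i) (splitAt (suc n) j)
                  (Finₚ.<⇒≢ i<j ∘ splitAt-injective (suc n)) same

    point-by-lifting-y : ∀ a b c x₀ {y₀} → ¬ + p ∣ₛ b → ¬ + p ∣ₛ y₀ →
                         + p ∣ₛ a * x₀ * x₀ + b * y₀ * y₀ - 1ℤ → HasZpPoint p a b c
    point-by-lifting-y a b c x₀ {y₀} p∤b p∤y₀ p∣e =
      let zpRoot y solves = hensel (1ℤ - a * x₀ * x₀) p∤b p∤y₀
                                   (subst (_ ∣ₛ_) (isolate a b x₀ y₀) p∣e)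
      in pointOf a b c (constant x₀) y (constant 0ℤ)
                 (λ k → subst (_ ∣ₛ_) (expand a b c x₀ (digits y k)) (solves k))
      where
      isolate : ∀ a b x y → a * x * x + b * y * y - 1ℤ ≡ b * y * y - (1ℤ - a * x * x)
      isolate = solve-∀
      expand : ∀ a b c x y →
        b * y * y - (1ℤ - a * x * x) ≡ a * x * x + b * y * y + c * c * 0ℤ * 0ℤ - 1ℤ
      expand = solve-∀

    point-if-p∤c : ∀ a b c → ¬ + p ∣ₛ c → HasZpPoint p a b c
    point-if-p∤c a b c p∤c with inverse-mod-prime c p∤c
    ... | h , p∣ch-1 =
      let zpRoot z solves = hensel 1ℤ (prime∤* p∤c p∤c) (inverse∤ c h p∣ch-1) p∣cchh-1
      in pointOf a b c (constant 0ℤ) (constant 0ℤ) z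
                 (λ k → subst (_ ∣ₛ_) (expand a b c (digits z k)) (solves k))
      where
      difference-of-squares : ∀ c h → (c * h - 1ℤ) * (c * h + 1ℤ) ≡ c * c * h * h - 1ℤ
      difference-of-squares = solve-∀
      expand : ∀ a b c z → c * c * z * z - 1ℤ ≡ a * 0ℤ * 0ℤ + b * 0ℤ * 0ℤ + c * c * z * z - 1ℤ
      expand = solve-∀
      p∣cchh-1 : + p ∣ₛ c * c * h * h - 1ℤ
      p∣cchh-1 = subst (_ ∣ₛ_) (difference-of-squares c h) (Signed.∣m⇒∣m*n (c * h + 1ℤ) p∣ch-1)

    point-if-QuadRes : ∀ a b c → ¬ + p ∣ₛ b → QuadRes b p → HasZpPoint p a b c
    point-if-QuadRes a b c p∤b (t , t²≡b) with inverse-mod-prime b p∤b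
    ... | h , p∣bh-1 = point-by-lifting-y a b c 0ℤ p∤b (inverse∤ (b * (h * t)) (h * t) p∣e)
                                          (subst (_ ∣ₛ_) (add-x=0 a b (h * t)) p∣e)
      where
      square : ∀ b t h →
        h * h * b * (t * t - b) + (b * h + 1ℤ) * (b * h - 1ℤ) ≡ b * (h * t) * (h * t) - 1ℤ
      square = solve-∀
      add-x=0 : ∀ a b y → b * y * y - 1ℤ ≡ a * 0ℤ * 0ℤ + b * y * y - 1ℤ
      add-x=0 = solve-∀
      p∣e : + p ∣ₛ b * (h * t) * (h * t) - 1ℤ
      p∣e = subst (_ ∣ₛ_) (square b t h)
                  (Signed.∣m∣n⇒∣m+n (Signed.∣n⇒∣m*n (h * h * b) (∣ᵤ⇒∣ t²≡b))
                                    (Signed.∣n⇒∣m*n (b * h + 1ℤ) p∣bh-1))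

    point-if-units : ∀ a b c → ¬ + p ∣ₛ a → ¬ + p ∣ₛ b → HasZpPoint p a b c
    point-if-units a b c p∤a p∤b with conic-mod-p p∤a p∤b
    ... | x₀ , y₀ , p∣e with + p ∣? y₀
    ...   | no p∤y₀  = point-by-lifting-y a b c x₀ p∤b p∤y₀ p∣e
    ...   | yes p∣y₀ = HasZpPoint-swap b a c (point-by-lifting-y b a c y₀ p∤a p∤x₀
                         (subst (_ ∣ₛ_) (cong (_- 1ℤ) (ℤₚ.+-comm (a * x₀ * x₀) (b * y₀ * y₀))) p∣e))
      where
      p∤x₀ : ¬ + p ∣ₛ x₀
      p∤x₀ p∣x₀ = ∣m⇒∤m-1 (Signed.∣m∣n⇒∣m+n (Signed.∣m⇒∣m*n x₀ (Signed.∣n⇒∣m*n a p∣x₀))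
                                             (Signed.∣m⇒∣m*n y₀ (Signed.∣n⇒∣m*n b p∣y₀))) p∣e

    sufficient : ∀ a b c → ¬ + p ∣ gcd (gcd a b) c →
                 (+ p ∣ gcd a c → QuadRes b p) → (+ p ∣ gcd b c → QuadRes a p) → HasZpPoint p a b c
    sufficient a b c p∤gcd b-square a-square with + p ∣? c
    ... | no p∤c = point-if-p∤c a b c p∤c
    ... | yes p∣c with + p ∣? a | + p ∣? b
    ...   | yes p∣a | yes p∣b =
      contradiction (∣ₛ⇒∣gcd (∣ᵤ⇒∣ {i = gcd a b} (∣ₛ⇒∣gcd p∣a p∣b)) p∣c) p∤gcd
    ...   | yes p∣a | no p∤b  = point-if-QuadRes a b c p∤b (b-square (∣ₛ⇒∣gcd p∣a p∣c))
    ...   | no p∤a  | yes p∣b =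
      HasZpPoint-swap b a c (point-if-QuadRes b a c p∤a (a-square (∣ₛ⇒∣gcd p∣b p∣c)))
    ...   | no p∤a  | no p∤b  = point-if-units a b c p∤a p∤b

lemma5p1 : (a b c : ℤ) → a ≢ 0ℤ → b ≢ 0ℤ → c ≢ 0ℤ → ¬ ((0ℤ < a) × (0ℤ < b))
    → (p : ℕ) → Prime p → p ≢ 2
    → HasZpPoint p a b c
      ⇔ ((¬ ((+ p) ∣ gcd (gcd a b) c))
         × (((+ p) ∣ gcd a c → QuadRes b p)
         × ((+ p) ∣ gcd b c → QuadRes a p)))
lemma5p1 a b c _ _ _ _ p p-prime p≢2 =
  mk⇔ (necessary p-prime a b c)
      (λ (p∤gcd , b-square , a-square) → sufficient p-prime p≢2 a b c p∤gcd b-square a-square)
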